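{- Let $w$ be a sequence consisting of $k$ zeros and $k$ ones, and let $a_1,\dots,a_k$ be an ordering of the $k$ zeros (as positions of $w$). Define $b_1$ to be the first $1$ cyclically to the right of $a_1$, and inductively $b_i$ to be the first $1$ cyclically to the right of $a_i$ that is different from $b_1,\dots,b_{i-1}$. The crossing number is the number of indices $i$ such that $b_i$ is to the left of $a_i$. Then the crossing number of $w$ does not depend on the choice of the ordering $a_1,\dots,a_k$ of the zeros.
   Context: "Cyclically to the right" means scanning to the right and wrapping around from the last position to the first if necessary. -}

module Defs where

open import Data.Bool using (Bool; true; false; T; not)
open import Data.Nat using (ℕ; zero; suc; _+_; _<_; _≤_; _<?_; _≤?_)
open import Data.Fin using (Fin; toℕ)
open import Data.Fin.Properties using () renaming (_≟_ to _≟ᶠ_)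
open import Data.List using (List; []; _∷_; _++_; filter; length)
open import Data.List.Base using (allFin)
open import Data.List.Membership.Propositional using (_∈_)
open import Data.List.Relation.Unary.Any using (any?)
open import Data.List.Relation.Unary.All using (All)
open import Data.List.Relation.Unary.Unique.Propositional using (Unique)
open import Data.Maybe using (Maybe; just; nothing)
open import Relation.Nullary using (yes; no; ¬_)
open import Data.Product using (_×_)
open import Relation.Binary.PropositionalEquality using (_≡_)
open import Relation.Nullary.Decidable using (T?)

-- A binary word of length n: w i is the letter at position i (false = 0, true = 1).
Word : ℕ → Set
Word n = Fin n → Bool

positionsOf : ∀ {n} → Word n → Bool → List (Fin n)
positionsOf {n} w true  = filter (λ i → T? (w i)) (allFin n)
positionsOf {n} w false = filter (λ i → T? (not (w i))) (allFin n)

#zeros #ones : ∀ {n} → Word n → ℕ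
#zeros w = length (positionsOf w false)
#ones  w = length (positionsOf w true)

cyclicFrom : ∀ {n} → Fin n → List (Fin n)
cyclicFrom {n} a =
  filter (λ i → toℕ a <? toℕ i) (allFin n) ++ filter (λ i → toℕ i ≤? toℕ a) (allFin n)

firstFree : ∀ {n} → Word n → List (Fin n) → List (Fin n) → Maybe (Fin n)
firstFree w used [] = nothing
firstFree w used (c ∷ cs) with w c | any? (c ≟ᶠ_) used
... | true | no _ = just c
... | _    | _    = firstFree w used cs

nextOne : ∀ {n} → Word n → List (Fin n) → Fin n → Maybe (Fin n)
nextOne w used a = firstFree w used (cyclicFrom a)

-- Process a_1, …, a_k in order; `used` holds b_1, …, b_{i-1}.
-- Counts indices i with b_i strictly to the left of a_i.
crossingAux : ∀ {n} → Word n → List (Fin n) → List (Fin n) → ℕ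
crossingAux w used [] = 0
crossingAux w used (a ∷ as) with nextOne w used a
... | nothing = crossingAux w used as
... | just b with toℕ b <? toℕ a
...   | yes _ = suc (crossingAux w (b ∷ used) as)
...   | no  _ = crossingAux w (b ∷ used) as

crossingNumber : ∀ {n} → Word n → List (Fin n) → ℕ
crossingNumber w order = crossingAux w [] order

IsZeroOrdering : ∀ {n} → Word n → List (Fin n) → Set
IsZeroOrdering w order =
  Unique order × All (λ i → w i ≡ false) order × (∀ i → w i ≡ false → i ∈ order)

-- When w has as many zeros as ones, the crossing number for any ordering of the zeros is
-- max_j (#zeros at positions ≥ j − #ones at positions ≥ j), which depends on w alone.
-- This is an invariant of the matching process: if R lists the zeros still to be
-- processed and a one is free while it is unmatched, the number of crossings still to
-- come is  max_j (#R at positions ≥ j − #free ones at positions ≥ j).  Matching a to b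
-- lowers the first count on suffixes starting at or before a and the second on suffixes
-- starting at or before b. If b lies right of a, the ones strictly between them are all
-- matched already, so a suffix starting in (a, b] may be traded for the one starting at a
-- and the maximum is unchanged. If the search wraps around, every other free one lies in
-- (b, a), and the maximum grows by exactly one: the crossing produced by this step.
module Submission where

open import Defs
open import Data.Bool using (Bool; true; false; not; _∧_; _∨_; if_then_else_)
open import Data.Bool.Properties using (∧-zeroʳ; ∧-identityʳ; ∨-zeroʳ; not-¬)
open import Data.Empty using (⊥-elim)
open import Data.Fin using (Fin; toℕ; zero; suc)
open import Data.Fin.Properties using (toℕ-injective; toℕ<n)
  renaming (_≟_ to _≟ᶠ_; suc-injective to sucᶠ-injective)
open import Data.List using (List; []; _∷_; _++_; filter; length; tabulate; allFin)
open import Data.List.Membership.Propositional using (_∈_; _∉_)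
open import Data.List.Membership.Propositional.Properties
  using (∈-filter⁺; ∈-filter⁻; ∈-allFin; ∈-++⁺ˡ; ∈-++⁺ʳ)
open import Data.List.Relation.Unary.All as All using (All; []; _∷_)
open import Data.List.Relation.Unary.All.Properties using (All¬⇒¬Any)
open import Data.List.Relation.Unary.AllPairs using (AllPairs; []; _∷_)
import Data.List.Relation.Unary.AllPairs.Properties as AllPairs
open import Data.List.Relation.Unary.Any using (here; there; any?)
open import Data.List.Relation.Unary.Unique.Propositional using (Unique)
open import Data.Maybe using (just; nothing; _<∣>_)
open import Data.Nat using (ℕ; zero; suc; _+_; _≤_; _<_; _≤?_; _<?_; z≤n; s≤s)
open import Data.Nat.Properties
open import Data.Product using (_×_; _,_; proj₂; ∃-syntax)
open import Data.Sum using (inj₁; inj₂)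
open import Function using (_∘_; id)
open import Relation.Binary.PropositionalEquality
open import Relation.Nullary using (does; yes; no)
open import Relation.Nullary.Decidable using (T?; dec-true; dec-false)

countFrom : ∀ {n} → (Fin n → Bool) → ℕ → ℕ
countFrom {zero}  P _       = 0
countFrom {suc n} P zero    = (if P zero then 1 else 0) + countFrom (P ∘ suc) zero
countFrom {suc n} P (suc j) = countFrom (P ∘ suc) j

countFrom-cong : ∀ {n} {P Q : Fin n → Bool} → P ≗ Q → countFrom P ≗ countFrom Q
countFrom-cong {zero}  P≗Q _       = refl
countFrom-cong {suc n} P≗Q zero    =
  cong₂ _+_ (cong (if_then 1 else 0) (P≗Q zero)) (countFrom-cong (P≗Q ∘ suc) zero)
countFrom-cong {suc n} P≗Q (suc j) = countFrom-cong (P≗Q ∘ suc) j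

countFrom-antitone : ∀ {n} (P : Fin n → Bool) {i j} → i ≤ j → countFrom P j ≤ countFrom P i
countFrom-antitone {zero}  P _                          = z≤n
countFrom-antitone {suc n} P {zero}  {zero}  _          = ≤-refl
countFrom-antitone {suc n} P {zero}  {suc j} _          =
  ≤-trans (countFrom-antitone (P ∘ suc) z≤n) (m≤n+m _ _)
countFrom-antitone {suc n} P {suc i} {suc j} (s≤s i≤j) = countFrom-antitone (P ∘ suc) i≤j

countFrom-none : ∀ {n} (P : Fin n → Bool) j → (∀ i → j ≤ toℕ i → P i ≡ false) → countFrom P j ≡ 0
countFrom-none {zero}  P _       _    = refl
countFrom-none {suc n} P zero    none
  rewrite none zero z≤n = countFrom-none (P ∘ suc) zero (λ i _ → none (suc i) z≤n)
countFrom-none {suc n} P (suc j) none = countFrom-none (P ∘ suc) j (λ i j≤i → none (suc i) (s≤s j≤i))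

countFrom-flat : ∀ {n} (P : Fin n → Bool) {s t} → s ≤ t →
  (∀ i → s ≤ toℕ i → toℕ i < t → P i ≡ false) → countFrom P s ≡ countFrom P t
countFrom-flat {zero}  P _                 _    = refl
countFrom-flat {suc n} P {zero}  {zero}  _ _    = refl
countFrom-flat {suc n} P {zero}  {suc t} _ none
  rewrite none zero z≤n (s≤s z≤n) =
  countFrom-flat (P ∘ suc) z≤n (λ i _ i<t → none (suc i) z≤n (s≤s i<t))
countFrom-flat {suc n} P {suc s} {suc t} (s≤s s≤t) none =
  countFrom-flat (P ∘ suc) s≤t (λ i s≤i i<t → none (suc i) (s≤s s≤i) (s≤s i<t))

record Bump (F f : ℕ → ℕ) (x : ℕ) : Set where
  field
    below : ∀ {j} → j ≤ x → F j ≡ suc (f j)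
    above : ∀ {j} → x < j → F j ≡ f j

open Bump

bump-≤₀ : ∀ {Z z O o A B} → Bump Z z A → Bump O o B → Z 0 ≤ O 0 → z 0 ≤ o 0
bump-≤₀ bumpZ bumpO Z0≤O0 = ≤-pred (subst₂ _≤_ (below bumpZ z≤n) (below bumpO z≤n) Z0≤O0)

countFrom-bump : ∀ {n} {P Q : Fin n → Bool} (x : Fin n) → P x ≡ true → Q x ≡ false →
  (∀ i → i ≢ x → P i ≡ Q i) → Bump (countFrom P) (countFrom Q) (toℕ x)
countFrom-bump {suc n} {P} {Q} zero Px Qx P≡Q = record { below = below′ ; above = above′ }
  where
    tails : countFrom (P ∘ suc) ≗ countFrom (Q ∘ suc)
    tails = countFrom-cong (λ i → P≡Q (suc i) λ ())
    below′ : ∀ {j} → j ≤ 0 → countFrom P j ≡ suc (countFrom Q j)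
    below′ z≤n rewrite Px | Qx = cong suc (tails zero)
    above′ : ∀ {j} → 0 < j → countFrom P j ≡ countFrom Q j
    above′ {suc j} _ = tails j
countFrom-bump {suc n} {P} {Q} (suc x) Px Qx P≡Q = record { below = below′ ; above = above′ }
  where
    tails : Bump (countFrom (P ∘ suc)) (countFrom (Q ∘ suc)) (toℕ x)
    tails = countFrom-bump x Px Qx (λ i i≢x → P≡Q (suc i) (i≢x ∘ sucᶠ-injective))
    below′ : ∀ {j} → j ≤ suc (toℕ x) → countFrom P j ≡ suc (countFrom Q j)
    below′ {zero} _ rewrite P≡Q zero (λ ()) =
      trans (cong (_ +_) (below tails z≤n)) (+-suc _ _)
    below′ {suc j} (s≤s j≤x) = below tails j≤x
    above′ : ∀ {j} → suc (toℕ x) < j → countFrom P j ≡ countFrom Q j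
    above′ {suc j} (s≤s x<j) = above tails x<j

countFrom-tabulate : ∀ {n} {A : Set} (P : A → Bool) (g : Fin n → A) →
  countFrom (P ∘ g) 0 ≡ length (filter (T? ∘ P) (tabulate g))
countFrom-tabulate {zero}  P g = refl
countFrom-tabulate {suc n} P g with P (g zero)
... | true  = cong suc (countFrom-tabulate P (g ∘ suc))
... | false = countFrom-tabulate P (g ∘ suc)

-- m is the largest value of  Z j − O j  (as an integer) over j ∈ ℕ.
record MaxExcess (Z O : ℕ → ℕ) (m : ℕ) : Set where
  field
    bounded  : ∀ j → Z j ≤ m + O j
    attained : ∃[ j ] Z j ≡ m + O j

open MaxExcess

maxExcess-cong : ∀ {Z Z′ O O′ m} → Z ≗ Z′ → O ≗ O′ → MaxExcess Z O m → MaxExcess Z′ O′ m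
maxExcess-cong {m = m} Z≗Z′ O≗O′ e = record
  { bounded  = λ j → subst₂ (λ z o → z ≤ m + o) (Z≗Z′ j) (O≗O′ j) (bounded e j)
  ; attained = let j , Zj≡ = attained e in
               j , subst₂ (λ z o → z ≡ m + o) (Z≗Z′ j) (O≗O′ j) Zj≡
  }

maxExcess-unique : ∀ {Z O m m′} → MaxExcess Z O m → MaxExcess Z O m′ → m ≡ m′
maxExcess-unique e e′ = ≤-antisym (atMost e e′) (atMost e′ e)
  where
    atMost : ∀ {Z O m m′} → MaxExcess Z O m → MaxExcess Z O m′ → m ≤ m′
    atMost {O = O} {m} {m′} e e′ =
      let j , Zj≡ = attained e in
      +-cancelʳ-≤ (O j) m m′ (subst (_≤ m′ + O j) Zj≡ (bounded e′ j))

module _ {z o Z O : ℕ → ℕ} {A B m : ℕ} (bumpZ : Bump Z z A) (bumpO : Bump O o B)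
         (z-antitone : ∀ {i j} → i ≤ j → z j ≤ z i) where

  maxExcess-forward : A < B → (∀ j → A ≤ j → j ≤ B → o j ≡ o A) →
    MaxExcess z o m → MaxExcess Z O m
  maxExcess-forward A<B o-flat e = record { bounded = bounded′ ; attained = attained′ }
    where
      bounded′ : ∀ j → Z j ≤ m + O j
      bounded′ j with j ≤? A | j ≤? B
      ... | yes j≤A | _ rewrite below bumpZ j≤A | below bumpO (≤-trans j≤A (<⇒≤ A<B)) | +-suc m (o j) =
        s≤s (bounded e j)
      ... | no j≰A | yes j≤B rewrite above bumpZ (≰⇒> j≰A) | below bumpO j≤B | +-suc m (o j) =
        m≤n⇒m≤1+n (bounded e j)
      ... | no j≰A | no j≰B rewrite above bumpZ (≰⇒> j≰A) | above bumpO (≰⇒> j≰B) = bounded e j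
      lift : ∀ j → z j ≡ m + o j → j ≤ A → Z j ≡ m + O j
      lift j zj≡ j≤A rewrite below bumpZ j≤A | below bumpO (≤-trans j≤A (<⇒≤ A<B)) | +-suc m (o j) =
        cong suc zj≡
      attained′ : ∃[ j ] Z j ≡ m + O j
      attained′ with attained e
      ... | j , zj≡ with j ≤? A | j ≤? B
      ...   | yes j≤A | _ = j , lift j zj≡ j≤A
      ...   | no j≰A | no j≰B =
        j , trans (above bumpZ (≰⇒> j≰A)) (trans zj≡ (cong (m +_) (sym (above bumpO (≰⇒> j≰B)))))
      -- o is constant on [A, j] and z is antitone, so A does at least as well as j
      ...   | no j≰A | yes j≤B = A , lift A zA≡ ≤-refl
        where
          A≤j = <⇒≤ (≰⇒> j≰A)
          zA≡ : z A ≡ m + o A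
          zA≡ = ≤-antisym (bounded e A)
            (subst (_≤ z A) (trans zj≡ (cong (m +_) (o-flat j A≤j j≤B))) (z-antitone A≤j))

  maxExcess-wrapped : B < A → (∀ j → j ≤ B → o j ≡ o 0) → (∀ j → A ≤ j → o j ≡ 0) →
    z 0 ≤ o 0 → MaxExcess z o m → MaxExcess Z O (suc m)
  maxExcess-wrapped B<A o-flat o-none z0≤o0 e = record { bounded = bounded′ ; attained = attained′ }
    where
      bounded′ : ∀ j → Z j ≤ suc m + O j
      bounded′ j with j ≤? B | j ≤? A
      ... | yes j≤B | _ rewrite below bumpZ (≤-trans j≤B (<⇒≤ B<A)) | below bumpO j≤B | +-suc m (o j) =
        s≤s (m≤n⇒m≤1+n (bounded e j))
      ... | no j≰B | yes j≤A rewrite below bumpZ j≤A | above bumpO (≰⇒> j≰B) = s≤s (bounded e j)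
      ... | no j≰B | no j≰A rewrite above bumpZ (≰⇒> j≰A) | above bumpO (<-trans B<A (≰⇒> j≰A)) =
        m≤n⇒m≤1+n (bounded e j)
      lift : ∀ j → z j ≡ m + o j → B < j → j ≤ A → Z j ≡ suc m + O j
      lift j zj≡ B<j j≤A rewrite below bumpZ j≤A | above bumpO B<j = cong suc zj≡
      attainedAtA : m ≤ z A → ∃[ j ] Z j ≡ suc m + O j
      attainedAtA m≤zA = A , lift A zA≡ B<A ≤-refl
        where
          zA≡ : z A ≡ m + o A
          zA≡ = ≤-antisym (bounded e A)
            (subst (_≤ z A) (sym (trans (cong (m +_) (o-none A ≤-refl)) (+-identityʳ m))) m≤zA)
      attained′ : ∃[ j ] Z j ≡ suc m + O j
      attained′ with attained e
      ... | j , zj≡ with j ≤? B | j ≤? A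
      ...   | no j≰B | yes j≤A = j , lift j zj≡ (≰⇒> j≰B) j≤A
      ...   | no j≰B | no j≰A = attainedAtA (≤-trans (≤-trans (m≤m+n m (o j)) (≤-reflexive (sym zj≡)))
                                                    (z-antitone (<⇒≤ (≰⇒> j≰A))))
      -- here  m + o 0 = z j ≤ z 0 ≤ o 0,  so m = 0
      ...   | yes j≤B | _ = attainedAtA (subst (_≤ z A) (sym m≡0) z≤n)
        where
          m≡0 : m ≡ 0
          m≡0 = n≤0⇒n≡0 (+-cancelʳ-≤ (o 0) m 0
            (subst (_≤ o 0) (trans zj≡ (cong (m +_) (o-flat j j≤B))) (≤-trans (z-antitone z≤n) z0≤o0)))

_∈ᵇ_ : ∀ {n} → Fin n → List (Fin n) → Bool
i ∈ᵇ xs = does (any? (i ≟ᶠ_) xs)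

∈ᵇ-≢ : ∀ {n} {i x : Fin n} xs → i ≢ x → i ∈ᵇ (x ∷ xs) ≡ i ∈ᵇ xs
∈ᵇ-≢ {i = i} {x} xs i≢x = cong (_∨ i ∈ᵇ xs) (dec-false (i ≟ᶠ x) i≢x)

membersFrom : ∀ {n} → List (Fin n) → ℕ → ℕ
membersFrom xs = countFrom (_∈ᵇ xs)

membersFrom-∷ : ∀ {n} {x : Fin n} {xs} → x ∉ xs → Bump (membersFrom (x ∷ xs)) (membersFrom xs) (toℕ x)
membersFrom-∷ {x = x} {xs} x∉xs =
  countFrom-bump x (dec-true (any? (x ≟ᶠ_) (x ∷ xs)) (here refl)) (dec-false (any? (x ≟ᶠ_) xs) x∉xs)
    (λ i i≢x → ∈ᵇ-≢ xs i≢x)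

Sorted : ∀ {n} → List (Fin n) → Set
Sorted = AllPairs (λ i j → toℕ i < toℕ j)

module _ {n} (w : Word n) where

  free : List (Fin n) → Fin n → Bool
  free used i = w i ∧ not (i ∈ᵇ used)

  free-zero : ∀ {i} used → w i ≡ false → free used i ≡ false
  free-zero used w≡ rewrite w≡ = refl

  free-∷ : ∀ {i} used b → free used i ≡ false → free (b ∷ used) i ≡ false
  free-∷ {i} used b h with w i | i ∈ᵇ used
  ... | false | _    = refl
  ... | true  | true = cong not (∨-zeroʳ (does (i ≟ᶠ b)))

  firstFree-∷ : ∀ used c cs →
    firstFree w used (c ∷ cs) ≡ (if free used c then just c else firstFree w used cs)
  firstFree-∷ used c cs with w c | any? (c ≟ᶠ_) used
  ... | true  | yes _ = refl
  ... | true  | no _  = refl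
  ... | false | _     = refl

  firstFree-++ : ∀ used xs ys → firstFree w used (xs ++ ys) ≡ (firstFree w used xs <∣> firstFree w used ys)
  firstFree-++ used []       ys = refl
  firstFree-++ used (c ∷ cs) ys rewrite firstFree-∷ used c (cs ++ ys) | firstFree-∷ used c cs
    with free used c
  ... | true  = refl
  ... | false = firstFree-++ used cs ys

  firstFree-nothing : ∀ {used} xs → firstFree w used xs ≡ nothing → All (λ c → free used c ≡ false) xs
  firstFree-nothing          []       _  = []
  firstFree-nothing {used} (c ∷ cs) eq with free used c in free-c | trans (sym (firstFree-∷ used c cs)) eq
  ... | false | eq′ = free-c ∷ firstFree-nothing cs eq′

  firstFree-just : ∀ {used b} xs → Sorted xs → firstFree w used xs ≡ just b →
    b ∈ xs × free used b ≡ true × (∀ c → c ∈ xs → toℕ c < toℕ b → free used c ≡ false)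
  firstFree-just {used} (c ∷ cs) (c<cs ∷ sorted) eq
    with free used c in free-c | trans (sym (firstFree-∷ used c cs)) eq
  ... | true | refl = here refl , free-c , λ
    { d (here refl) d<c  → ⊥-elim (<-irrefl refl d<c)
    ; d (there d∈cs) d<c → ⊥-elim (<-asym d<c (All.lookup c<cs d∈cs)) }
  ... | false | eq′ =
    let b∈cs , free-b , earlier = firstFree-just cs sorted eq′ in
    there b∈cs , free-b , λ
    { d (here refl) _    → free-c
    ; d (there d∈cs) d<b → earlier d d∈cs d<b }

  data CyclicSuccessor (used : List (Fin n)) (a b : Fin n) : Set where
    forward : toℕ a < toℕ b → (∀ c → toℕ a < toℕ c → toℕ c < toℕ b → free used c ≡ false) →
              CyclicSuccessor used a b
    wrapped : toℕ b ≤ toℕ a → (∀ c → toℕ a < toℕ c → free used c ≡ false) →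
              (∀ c → toℕ c < toℕ b → free used c ≡ false) → CyclicSuccessor used a b

  module _ (used : List (Fin n)) (a : Fin n) where

    private
      after upTo : List (Fin n)
      after = filter (λ i → toℕ a <? toℕ i) (allFin n)
      upTo  = filter (λ i → toℕ i ≤? toℕ a) (allFin n)

      ∈-after : ∀ {c} → toℕ a < toℕ c → c ∈ after
      ∈-after = ∈-filter⁺ (λ i → toℕ a <? toℕ i) (∈-allFin _)

      ∈-upTo : ∀ {c} → toℕ c ≤ toℕ a → c ∈ upTo
      ∈-upTo = ∈-filter⁺ (λ i → toℕ i ≤? toℕ a) (∈-allFin _)

      sorted-allFin : Sorted (allFin n)
      sorted-allFin = AllPairs.tabulate⁺-< (λ i<j → i<j)

    nextOne-nothing : nextOne w used a ≡ nothing → ∀ c → free used c ≡ false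
    nextOne-nothing eq c = All.lookup (firstFree-nothing (after ++ upTo) eq) c∈cyclic
      where
        c∈cyclic : c ∈ after ++ upTo
        c∈cyclic with toℕ a <? toℕ c
        ... | yes a<c = ∈-++⁺ˡ (∈-after a<c)
        ... | no a≮c  = ∈-++⁺ʳ after (∈-upTo (≮⇒≥ a≮c))

    nextOne-just : ∀ {b} → nextOne w used a ≡ just b → free used b ≡ true × CyclicSuccessor used a b
    nextOne-just eq with firstFree w used after in found-after | trans (sym (firstFree-++ used after upTo)) eq
    ... | just _ | refl =
      let b∈ , free-b , earlier = firstFree-just after (AllPairs.filter⁺ _ sorted-allFin) found-after in
      free-b , forward (proj₂ (∈-filter⁻ (λ i → toℕ a <? toℕ i) {xs = allFin n} b∈))
                       (λ c a<c → earlier c (∈-after a<c))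
    ... | nothing | found-upTo =
      let b∈ , free-b , earlier = firstFree-just upTo (AllPairs.filter⁺ _ sorted-allFin) found-upTo in
      let b≤a = proj₂ (∈-filter⁻ (λ i → toℕ i ≤? toℕ a) {xs = allFin n} b∈) in
      free-b , wrapped b≤a (λ c a<c → All.lookup (firstFree-nothing after found-after) (∈-after a<c))
                           (λ c c<b → earlier c (∈-upTo (≤-trans (<⇒≤ c<b) b≤a)) c<b)

  freeOnesFrom : List (Fin n) → ℕ → ℕ
  freeOnesFrom used = countFrom (free used)

  freeOnesFrom-∷ : ∀ {b} used → free used b ≡ true →
    Bump (freeOnesFrom used) (freeOnesFrom (b ∷ used)) (toℕ b)
  freeOnesFrom-∷ {b} used free-b =
    countFrom-bump b free-b b-used (λ i i≢b → cong (λ u → w i ∧ not u) (sym (∈ᵇ-≢ used i≢b)))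
    where
      b-used : free (b ∷ used) b ≡ false
      b-used = trans (cong (λ u → w b ∧ not u) (dec-true (any? (b ≟ᶠ_) (b ∷ used)) (here refl)))
                     (∧-zeroʳ (w b))

  free-∷-fromZero : ∀ {a i} used b → w a ≡ false → toℕ a ≤ toℕ i →
    (toℕ a < toℕ i → free used i ≡ false) → free (b ∷ used) i ≡ false
  free-∷-fromZero used b w-a a≤i used-i with m≤n⇒m<n∨m≡n a≤i
  ... | inj₁ a<i = free-∷ used b (used-i a<i)
  ... | inj₂ a≡i = free-zero (b ∷ used) (subst (λ x → w x ≡ false) (toℕ-injective a≡i) w-a)

  module _ (used : List (Fin n)) {a b : Fin n} (w-a : w a ≡ false) where

    freeOnesFrom-forward : (∀ c → toℕ a < toℕ c → toℕ c < toℕ b → free used c ≡ false) →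
      ∀ j → toℕ a ≤ j → j ≤ toℕ b → freeOnesFrom (b ∷ used) j ≡ freeOnesFrom (b ∷ used) (toℕ a)
    freeOnesFrom-forward between j a≤j j≤b = sym (countFrom-flat (free (b ∷ used)) a≤j
      (λ i a≤i i<j → free-∷-fromZero used b w-a a≤i (λ a<i → between i a<i (<-≤-trans i<j j≤b))))

    freeOnesFrom-wrapped : (∀ c → toℕ a < toℕ c → free used c ≡ false) →
      ∀ j → toℕ a ≤ j → freeOnesFrom (b ∷ used) j ≡ 0
    freeOnesFrom-wrapped beyond j a≤j = countFrom-none (free (b ∷ used)) j
      (λ i j≤i → free-∷-fromZero used b w-a (≤-trans a≤j j≤i) (beyond i))

  freeOnesFrom-prefix : ∀ {b} used → (∀ c → toℕ c < toℕ b → free used c ≡ false) →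
    ∀ j → j ≤ toℕ b → freeOnesFrom (b ∷ used) j ≡ freeOnesFrom (b ∷ used) 0
  freeOnesFrom-prefix {b} used before j j≤b =
    trans (flat-to-b j≤b) (sym (flat-to-b z≤n))
    where
      flat-to-b : ∀ {s} → s ≤ toℕ b → freeOnesFrom (b ∷ used) s ≡ freeOnesFrom (b ∷ used) (toℕ b)
      flat-to-b s≤b = countFrom-flat (free (b ∷ used)) s≤b (λ i _ i<b → free-∷ used b (before i i<b))

  crossingAux-maxExcess : ∀ used R → Unique R → All (λ i → w i ≡ false) R →
    membersFrom R 0 ≤ freeOnesFrom used 0 →
    MaxExcess (membersFrom R) (freeOnesFrom used) (crossingAux w used R)
  crossingAux-maxExcess used [] _ _ _ = record
    { bounded  = λ j → subst (_≤ freeOnesFrom used j) (sym (noMembers j)) z≤n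
    ; attained = n , trans (noMembers n)
                           (sym (countFrom-none (free used) n (λ i n≤i → ⊥-elim (<⇒≱ (toℕ<n i) n≤i))))
    }
    where
      noMembers : ∀ j → membersFrom {n} [] j ≡ 0
      noMembers j = countFrom-none {n} (_∈ᵇ []) j (λ _ _ → refl)
  crossingAux-maxExcess used (a ∷ R) (a≢R ∷ unique) (w-a ∷ zeros) enough = step
    where
      bumpZ : Bump (membersFrom (a ∷ R)) (membersFrom R) (toℕ a)
      bumpZ = membersFrom-∷ (All¬⇒¬Any a≢R)
      IH : ∀ {b} (free-b : free used b ≡ true) →
        MaxExcess (membersFrom R) (freeOnesFrom (b ∷ used)) (crossingAux w (b ∷ used) R)
      IH free-b = crossingAux-maxExcess _ R unique zeros (bump-≤₀ bumpZ (freeOnesFrom-∷ used free-b) enough)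
      step : MaxExcess (membersFrom (a ∷ R)) (freeOnesFrom used) (crossingAux w used (a ∷ R))
      step with nextOne w used a in next
      ... | nothing = ⊥-elim (n≮0 (subst₂ _≤_ (below bumpZ z≤n) noFreeOnes enough))
        where
          noFreeOnes : freeOnesFrom used 0 ≡ 0
          noFreeOnes = countFrom-none (free used) 0 (λ c _ → nextOne-nothing used a next c)
      ... | just b with toℕ b <? toℕ a | nextOne-just used a next
      ...   | yes b<a | _      , forward a<b _  = ⊥-elim (<-asym a<b b<a)
      ...   | no b≮a  | free-b , wrapped b≤a _ _
        with () ← trans (sym free-b)
                        (trans (cong (free used) (toℕ-injective (≤-antisym b≤a (≮⇒≥ b≮a)))) (free-zero used w-a))
      ...   | no _    | free-b , forward a<b between =
        maxExcess-forward bumpZ (freeOnesFrom-∷ used free-b) (countFrom-antitone (_∈ᵇ R)) a<b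
          (freeOnesFrom-forward used w-a between) (IH free-b)
      ...   | yes b<a | free-b , wrapped _ beyond before =
        maxExcess-wrapped bumpZ (freeOnesFrom-∷ used free-b) (countFrom-antitone (_∈ᵇ R)) b<a
          (freeOnesFrom-prefix used before) (freeOnesFrom-wrapped used w-a beyond)
          (bump-≤₀ bumpZ (freeOnesFrom-∷ used free-b) enough) (IH free-b)

  crossingNumber-maxExcess : ∀ {ord} → IsZeroOrdering w ord → #zeros w ≡ #ones w →
    MaxExcess (countFrom (not ∘ w)) (countFrom w) (crossingNumber w ord)
  crossingNumber-maxExcess {ord} (unique , zeros , complete) balanced =
    maxExcess-cong (countFrom-cong ord-is-zeros) (countFrom-cong (∧-identityʳ ∘ w))
      (crossingAux-maxExcess [] ord unique zeros (≤-reflexive enough))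
    where
      ord-is-zeros : ∀ i → i ∈ᵇ ord ≡ not (w i)
      ord-is-zeros i with w i in w-i
      ... | true  = dec-false (any? (i ≟ᶠ_) ord)
                      (λ i∈ord → not-¬ refl (trans (sym w-i) (All.lookup zeros i∈ord)))
      ... | false = dec-true (any? (i ≟ᶠ_) ord) (complete i w-i)
      enough : membersFrom ord 0 ≡ freeOnesFrom [] 0
      enough = begin
        membersFrom ord 0      ≡⟨ countFrom-cong ord-is-zeros 0 ⟩
        countFrom (not ∘ w) 0  ≡⟨ countFrom-tabulate (not ∘ w) id ⟩
        #zeros w               ≡⟨ balanced ⟩
        #ones w                ≡⟨ countFrom-tabulate w id ⟨
        countFrom w 0          ≡⟨ countFrom-cong (∧-identityʳ ∘ w) 0 ⟨
        freeOnesFrom [] 0      ∎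
        where open ≡-Reasoning

mainTheorem14 : (k : ℕ) (w : Word (k + k)) →
    #zeros w ≡ k → #ones w ≡ k →
    (ord₁ ord₂ : List (Fin (k + k))) →
    IsZeroOrdering w ord₁ → IsZeroOrdering w ord₂ →
    crossingNumber w ord₁ ≡ crossingNumber w ord₂
mainTheorem14 k w #zeros≡k #ones≡k ord₁ ord₂ zeroOrdering₁ zeroOrdering₂ =
  maxExcess-unique (crossingNumber-maxExcess w zeroOrdering₁ balanced)
                   (crossingNumber-maxExcess w zeroOrdering₂ balanced)
  where
    balanced : #zeros w ≡ #ones w
    balanced = trans #zeros≡k (sym #ones≡k)
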